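{- Let $G$ and $G'$ be graphs each containing at least one edge, and suppose $\operatorname{Z}(G')=\operatorname{Z}^*(G')$. Then \[\operatorname{Z}(G\Box G')\ge \operatorname{Z}(G)\operatorname{Z}(G')+1.\]
   Context: All graphs are finite, simple and undirected with nonempty vertex sets. Zero forcing: given a set $B\subseteq V(G)$ of initially filled vertices, the color change rule lets a filled vertex $u$ force (fill) an unfilled vertex $w$ if $w$ is the only unfilled neighbor of $u$; $B$ is a zero forcing set if repeated application of this rule eventually fills all of $V(G)$. $\operatorname{Z}(G)$ is the minimum cardinality of a zero forcing set of $G$. A fort of $G$ is a nonempty set $F\subseteq V(G)$ such that every $v\in V(G)\setminus F$ satisfies $|N_G(v)\cap F|\neq 1$; a minimal fort is a fort containing no other fort as a proper subset. The fractional zero forcing number is $\operatorname{Z}^*(G)=\min\{\sum_{v\in V(G)}x_v : \sum_{v\in F}x_v\ge 1 \text{ for every minimal fort } F \text{ of } G,\ x_v\ge 0 \text{ for all } v\in V(G)\}$. The Cartesian product $G\Box G'$ has vertex set $V(G)\times V(G')$, with $(u,u')$ adjacent to $(v,v')$ iff either $u=v$ and $u'v'\in E(G')$, or $u'=v'$ and $uv\in E(G)$. -}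

module Defs where

open import Data.Nat as ℕ using (ℕ; zero; suc; _*_)
open import Data.Bool using (Bool; true; false; if_then_else_; _∧_; _∨_)
open import Data.Fin using (Fin; remQuot; _≟_)
open import Data.Fin.Subset using (Subset; _∈_; _∉_; _⊂_; ∣_∣; _∩_; Nonempty)
open import Data.Vec using (tabulate; lookup)
open import Data.Product using (Σ; ∃; ∃-syntax; _×_; _,_; proj₁; proj₂)
open import Data.Integer using (+_)
open import Data.Rational as ℚ using (ℚ; 0ℚ; 1ℚ)
open import Relation.Binary.PropositionalEquality using (_≡_; _≢_)
open import Relation.Nullary using (¬_)
open import Relation.Nullary.Decidable using (⌊_⌋)

record Graph : Set where
  constructor graph
  field
    n   : ℕ
    adj : Fin n → Fin n → Bool
open Graph public

record IsSimple (G : Graph) : Set where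
  field
    nonempty : 1 ℕ.≤ n G
    symm     : ∀ u v → adj G u v ≡ adj G v u
    irrefl   : ∀ v → adj G v v ≡ false

HasEdge : Graph → Set
HasEdge G = ∃[ u ] ∃[ v ] adj G u v ≡ true

_□_ : Graph → Graph → Graph
G □ G' = graph (n G * n G') A
  where
  A : Fin (n G * n G') → Fin (n G * n G') → Bool
  A i j with remQuot (n G') i | remQuot (n G') j
  ... | (u , u') | (v , v') =
    (⌊ u ≟ v ⌋ ∧ adj G' u' v') ∨ (⌊ u' ≟ v' ⌋ ∧ adj G u v)

data Filled (G : Graph) (B : Subset (n G)) : Fin (n G) → Set where
  initial : ∀ {v} → v ∈ B → Filled G B v
  force   : ∀ {u v} → Filled G B u → adj G u v ≡ true →
            (∀ w → adj G u w ≡ true → w ≢ v → Filled G B w) →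
            Filled G B v

IsZeroForcingSet : (G : Graph) → Subset (n G) → Set
IsZeroForcingSet G B = ∀ v → Filled G B v

IsZ : Graph → ℕ → Set
IsZ G k = (∃[ B ] (IsZeroForcingSet G B × ∣ B ∣ ≡ k))
        × (∀ B → IsZeroForcingSet G B → k ℕ.≤ ∣ B ∣)

N : (G : Graph) → Fin (n G) → Subset (n G)
N G v = tabulate (adj G v)

IsFort : (G : Graph) → Subset (n G) → Set
IsFort G F = Nonempty F × (∀ v → v ∉ F → ∣ N G v ∩ F ∣ ≢ 1)

IsMinimalFort : (G : Graph) → Subset (n G) → Set
IsMinimalFort G F = IsFort G F × (∀ F' → F' ⊂ F → ¬ IsFort G F')

Σℚ : ∀ {m} → (Fin m → ℚ) → ℚ
Σℚ {zero}  f = 0ℚ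
Σℚ {suc m} f = f Fin.zero ℚ.+ Σℚ (λ i → f (Fin.suc i))
  where import Data.Fin as Fin

Σ∈ : ∀ {m} → Subset m → (Fin m → ℚ) → ℚ
Σ∈ F x = Σℚ (λ v → if lookup F v then x v else 0ℚ)

FeasibleFrac : (G : Graph) → (Fin (n G) → ℚ) → Set
FeasibleFrac G x = (∀ v → 0ℚ ℚ.≤ x v)
                 × (∀ F → IsMinimalFort G F → 1ℚ ℚ.≤ Σ∈ F x)

IsFracZ : Graph → ℚ → Set
IsFracZ G q = (∃[ x ] (FeasibleFrac G x × Σℚ x ≡ q))
            × (∀ x → FeasibleFrac G x → q ℚ.≤ Σℚ x)

ℕ→ℚ : ℕ → ℚ
ℕ→ℚ k = + k ℚ./ 1

-- Let B be a zero forcing set of G □ G' and let c(v') be the number of vertices of B in the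
-- column V(G) × {v'}.  For a fort F' of G', the vertices u of G whose row {u} × V(G') meets B
-- over F' (the shadow of B over F') form a zero forcing set of G, so every fort F' of G'
-- carries c-weight at least Z(G); hence c / Z(G) is feasible for the program defining Z*(G')
-- and |B| ≥ Z(G) Z*(G') = Z(G) Z(G').  For the extra 1, take b ∈ B, non-isolated in both
-- factors, all of whose neighbours but one (t) lie in B; every zero forcing set has one.
-- This yields a column v₀ with c(v₀) ≥ 1 such that every fort through v₀ has weight at least
-- Z(G) + 1, so c(v₀) may be lowered by one while c / Z(G) stays feasible.

module Submission where

open import Defs
open import Algebra.Properties.Semiring.Sum as Sum using ()
open import Data.Bool as Bool using (Bool; true; false; if_then_else_; _∧_; _∨_)
open import Data.Bool.Properties using (if-∧; if-swap-then; ∨-zeroʳ)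
open import Data.Empty using (⊥-elim)
open import Data.Fin using (Fin; zero; suc; combine; remQuot; _↑ˡ_; _↑ʳ_)
open import Data.Fin.Properties using (_≟_; any?; remQuot-combine; combine-remQuot)
open import Data.Fin.Subset using (Subset; _∈_; _∉_; _⊆_; _∩_; _-_; ∣_∣; ⊤; ⁅_⁆)
open import Data.Fin.Subset.Properties
  using (_∈?_; nonempty?; x∈p∩q⁺; x∈p∩q⁻; p⊆q⇒∣p∣≤∣q∣; ⊆-antisym; x∈⁅x⁆; x∈⁅y⁆⇒x≡y; ∣⁅x⁆∣≡1;
         x∈p∧x≢y⇒x∈p-y; x∈p⇒∣p-x∣<∣p∣)
import Data.Integer as ℤ
import Data.Integer.Properties as ℤ
open import Data.Nat using (ℕ; zero; suc; pred; _+_; _*_; _≤_; _<_; z≤n; s≤s; >-nonZero)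
open import Data.Nat.Coprimality as Coprimality using ()
open import Data.Nat.Properties
  using (+-mono-≤; +-mono-<-≤; +-mono-≤-<; +-assoc; +-comm; +-identityʳ; +-cancelʳ-≤;
         *-comm; *-zeroʳ; *-identityʳ; ≤-refl; ≤-trans; <-≤-trans; ≤-<-trans; suc-pred;
         +-*-semiring; module ≤-Reasoning)
open import Data.Product using (∃; ∃₂; _×_; _,_; proj₁; proj₂)
open import Data.Rational as ℚ using (ℚ; mkℚ; 0ℚ; 1ℚ)
import Data.Rational.Properties as ℚ
open import Data.Sum using (_⊎_; inj₁; inj₂)
open import Data.Vec using ([]; _∷_; lookup; tabulate)
open import Data.Vec.Functional using (updateAt)
open import Data.Vec.Properties
  using (lookup∘tabulate; lookup-zipWith; lookup-replicate; []=⇒lookup; lookup⇒[]=)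
open import Function using (_∘_)
open import Function.Bundles using (mk⇔)
open import Relation.Binary.PropositionalEquality
open import Relation.Nullary using (Dec; yes; no; does; ¬?; _×-dec_)
open import Relation.Nullary.Decidable using (⌊_⌋; dec-true; does-⇔; isYes≗does; decidable-stable)

open Sum +-*-semiring using (sum; sum-syntax; sum-cong-≗; ∑-comm; sum-replicate-zero)

private
  variable
    m m' : ℕ

sum-mono-≤ : {f g : Fin m → ℕ} → (∀ i → f i ≤ g i) → sum f ≤ sum g
sum-mono-≤ {zero}  f≤g = z≤n
sum-mono-≤ {suc m} f≤g = +-mono-≤ (f≤g zero) (sum-mono-≤ (f≤g ∘ suc))

sum-mono-< : {f g : Fin m → ℕ} → (∀ i → f i ≤ g i) → ∀ i → f i < g i → sum f < sum g
sum-mono-< f≤g zero    fi<gi = +-mono-<-≤ fi<gi (sum-mono-≤ (f≤g ∘ suc))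
sum-mono-< f≤g (suc i) fi<gi = +-mono-≤-< (f≤g zero) (sum-mono-< (f≤g ∘ suc) i fi<gi)

sum-↑ : ∀ m m' (f : Fin (m + m') → ℕ) →
        sum f ≡ ∑[ i < m ] f (i ↑ˡ m') + ∑[ j < m' ] f (m ↑ʳ j)
sum-↑ zero    m' f = refl
sum-↑ (suc m) m' f = trans (cong (f zero +_) (sum-↑ m m' (f ∘ suc))) (sym (+-assoc (f zero) _ _))

sum-combine : ∀ m m' (f : Fin (m * m') → ℕ) → sum f ≡ ∑[ u < m ] ∑[ v < m' ] f (combine u v)
sum-combine zero    m' f = refl
sum-combine (suc m) m' f =
  trans (sum-↑ m' (m * m') f)
        (cong (sum (λ v → f (combine {suc m} zero v)) +_) (sum-combine m m' (λ j → f (m' ↑ʳ j))))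

sum-if : ∀ b (f : Fin m → ℕ) → ∑[ i < m ] (if b then f i else 0) ≡ (if b then sum f else 0)
sum-if true  f = refl
sum-if {m} false f = sum-replicate-zero m

𝟙 : Bool → ℕ
𝟙 b = if b then 1 else 0

weight : Subset m → (Fin m → ℕ) → ℕ
weight p a = ∑[ i < _ ] (if lookup p i then a i else 0)

weight-⊤ : (a : Fin m → ℕ) → weight ⊤ a ≡ sum a
weight-⊤ a = sum-cong-≗ (λ i → cong (λ b → if b then a i else 0) (lookup-replicate i true))

weight-updateAt-pred : (p : Subset m) (a : Fin m → ℕ) (v : Fin m) → 0 < a v →
  weight p a ≡ weight p (updateAt a v pred) + 𝟙 (lookup p v)
weight-updateAt-pred (true ∷ p)  a zero 0<a₀ =
  trans (cong (_+ weight p (a ∘ suc)) (sym (suc-pred (a zero) {{>-nonZero 0<a₀}})))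
        (+-comm 1 (pred (a zero) + weight p (a ∘ suc)))
weight-updateAt-pred (false ∷ p) a zero _ = sym (+-identityʳ _)
weight-updateAt-pred (b ∷ p) a (suc v) 0<aᵥ =
  trans (cong ((if b then a zero else 0) +_) (weight-updateAt-pred p (a ∘ suc) v 0<aᵥ))
        (sym (+-assoc (if b then a zero else 0) _ _))

sum-updateAt-pred : (a : Fin m → ℕ) (v : Fin m) → 0 < a v → sum a ≡ sum (updateAt a v pred) + 1
sum-updateAt-pred a v 0<aᵥ = begin
  sum a                                          ≡⟨ weight-⊤ a ⟨
  weight ⊤ a                                     ≡⟨ weight-updateAt-pred ⊤ a v 0<aᵥ ⟩
  weight ⊤ (updateAt a v pred) + 𝟙 (lookup ⊤ v)  ≡⟨ cong₂ _+_ (weight-⊤ (updateAt a v pred))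
                                                              (cong 𝟙 (lookup-replicate v true)) ⟩
  sum (updateAt a v pred) + 1                    ∎
  where open ≡-Reasoning

∈-tabulate⁺ : {f : Fin m → Bool} {i : Fin m} → f i ≡ true → i ∈ tabulate f
∈-tabulate⁺ {f = f} {i} fi = lookup⇒[]= i (tabulate f) (trans (lookup∘tabulate f i) fi)

∈-tabulate⁻ : {f : Fin m → Bool} {i : Fin m} → i ∈ tabulate f → f i ≡ true
∈-tabulate⁻ {f = f} {i} i∈ = trans (sym (lookup∘tabulate f i)) ([]=⇒lookup i∈)

∣p∣≡∑𝟙 : (p : Subset m) → ∣ p ∣ ≡ ∑[ i < m ] 𝟙 (lookup p i)
∣p∣≡∑𝟙 []          = refl
∣p∣≡∑𝟙 (true ∷ p)  = cong suc (∣p∣≡∑𝟙 p)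
∣p∣≡∑𝟙 (false ∷ p) = ∣p∣≡∑𝟙 p

∣tabulate∣≡∑𝟙 : (f : Fin m → Bool) → ∣ tabulate f ∣ ≡ ∑[ i < m ] 𝟙 (f i)
∣tabulate∣≡∑𝟙 f = trans (∣p∣≡∑𝟙 (tabulate f)) (sum-cong-≗ (λ i → cong 𝟙 (lookup∘tabulate f i)))

x∈p⇒0<∣p∣ : {p : Subset m} {x : Fin m} → x ∈ p → 0 < ∣ p ∣
x∈p⇒0<∣p∣ {x = x} x∈p =
  subst (_≤ _) (∣⁅x⁆∣≡1 x) (p⊆q⇒∣p∣≤∣q∣ (λ y∈⁅x⁆ → subst (_∈ _) (sym (x∈⁅y⁆⇒x≡y x y∈⁅x⁆)) x∈p))

x∈p∧y∈p∧x≢y⇒1<∣p∣ : {p : Subset m} {x y : Fin m} → x ∈ p → y ∈ p → x ≢ y → 1 < ∣ p ∣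
x∈p∧y∈p∧x≢y⇒1<∣p∣ x∈p y∈p x≢y =
  <-≤-trans (s≤s (x∈p⇒0<∣p∣ (x∈p∧x≢y⇒x∈p-y y∈p (x≢y ∘ sym)))) (x∈p⇒∣p-x∣<∣p∣ x∈p)

nonempty?-indicator≤∣p∣ : (p : Subset m) → 𝟙 (does (nonempty? p)) ≤ ∣ p ∣
nonempty?-indicator≤∣p∣ p with nonempty? p
... | yes (_ , x∈p) = x∈p⇒0<∣p∣ x∈p
... | no _          = z≤n

nonempty?-indicator<∣p∣ : {p : Subset m} {x y : Fin m} → x ∈ p → y ∈ p → x ≢ y →
                          𝟙 (does (nonempty? p)) < ∣ p ∣
nonempty?-indicator<∣p∣ {p = p} x∈p y∈p x≢y =
  ≤-<-trans (indicator≤1 (does (nonempty? p))) (x∈p∧y∈p∧x≢y⇒1<∣p∣ x∈p y∈p x≢y)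
  where
  indicator≤1 : ∀ b → 𝟙 b ≤ 1
  indicator≤1 true  = s≤s z≤n
  indicator≤1 false = z≤n

ℕ→ℚ≡mkℚ : ∀ a → ℕ→ℚ a ≡ mkℚ (ℤ.+ a) 0 (Coprimality.sym (Coprimality.1-coprimeTo a))
ℕ→ℚ≡mkℚ a = ℚ.normalize-coprime (Coprimality.sym (Coprimality.1-coprimeTo a))

ℕ→ℚ-+ : ∀ a b → ℕ→ℚ (a + b) ≡ ℕ→ℚ a ℚ.+ ℕ→ℚ b
ℕ→ℚ-+ a b rewrite ℕ→ℚ≡mkℚ a | ℕ→ℚ≡mkℚ b =
  ℚ./-cong {ℤ.+ (a + b)} (sym (cong₂ ℤ._+_ (ℤ.*-identityʳ (ℤ.+ a)) (ℤ.*-identityʳ (ℤ.+ b)))) refl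

ℕ→ℚ-* : ∀ a b → ℕ→ℚ (a * b) ≡ ℕ→ℚ a ℚ.* ℕ→ℚ b
ℕ→ℚ-* a b rewrite ℕ→ℚ≡mkℚ a | ℕ→ℚ≡mkℚ b = ℚ./-cong {ℤ.+ (a * b)} (ℤ.pos-* a b) refl

ℕ→ℚ-mono-≤ : ∀ {a b} → a ≤ b → ℕ→ℚ a ℚ.≤ ℕ→ℚ b
ℕ→ℚ-mono-≤ {a} {b} a≤b rewrite ℕ→ℚ≡mkℚ a | ℕ→ℚ≡mkℚ b =
  ℚ.*≤* (subst₂ ℤ._≤_ (sym (ℤ.*-identityʳ (ℤ.+ a))) (sym (ℤ.*-identityʳ (ℤ.+ b))) (ℤ.+≤+ a≤b))

ℕ→ℚ-cancel-≤ : ∀ {a b} → ℕ→ℚ a ℚ.≤ ℕ→ℚ b → a ≤ b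
ℕ→ℚ-cancel-≤ {a} {b} le rewrite ℕ→ℚ≡mkℚ a | ℕ→ℚ≡mkℚ b with le
... | ℚ.*≤* a*1≤b*1 = ℤ.drop‿+≤+ (subst₂ ℤ._≤_ (ℤ.*-identityʳ (ℤ.+ a)) (ℤ.*-identityʳ (ℤ.+ b)) a*1≤b*1)

module _ (q : ℚ) where

  ℕ→ℚ-+-* : ∀ a b → ℕ→ℚ a ℚ.* q ℚ.+ ℕ→ℚ b ℚ.* q ≡ ℕ→ℚ (a + b) ℚ.* q
  ℕ→ℚ-+-* a b = trans (sym (ℚ.*-distribʳ-+ q (ℕ→ℚ a) (ℕ→ℚ b))) (cong (ℚ._* q) (sym (ℕ→ℚ-+ a b)))

  Σℚ-ℕ→ℚ-* : (a : Fin m → ℕ) → Σℚ (λ v → ℕ→ℚ (a v) ℚ.* q) ≡ ℕ→ℚ (sum a) ℚ.* q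
  Σℚ-ℕ→ℚ-* {zero}  a = sym (ℚ.*-zeroˡ q)
  Σℚ-ℕ→ℚ-* {suc m} a =
    trans (cong (ℕ→ℚ (a zero) ℚ.* q ℚ.+_) (Σℚ-ℕ→ℚ-* (a ∘ suc))) (ℕ→ℚ-+-* (a zero) (sum (a ∘ suc)))

  Σ∈-ℕ→ℚ-* : (p : Subset m) (a : Fin m → ℕ) → Σ∈ p (λ v → ℕ→ℚ (a v) ℚ.* q) ≡ ℕ→ℚ (weight p a) ℚ.* q
  Σ∈-ℕ→ℚ-* []      a = sym (ℚ.*-zeroˡ q)
  Σ∈-ℕ→ℚ-* (b ∷ p) a = trans (cong₂ ℚ._+_ (if-ℕ→ℚ-* b) (Σ∈-ℕ→ℚ-* p (a ∘ suc)))
                               (ℕ→ℚ-+-* (if b then a zero else 0) (weight p (a ∘ suc)))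
    where
    if-ℕ→ℚ-* : ∀ b → (if b then ℕ→ℚ (a zero) ℚ.* q else 0ℚ) ≡ ℕ→ℚ (if b then a zero else 0) ℚ.* q
    if-ℕ→ℚ-* true  = refl
    if-ℕ→ℚ-* false = sym (ℚ.*-zeroˡ q)

-- K is written as mkℚ rather than ℕ→ℚ (suc j): normalisation by gcd does not compute on an open
-- numerator, so the NonZero and Positive instances of ℕ→ℚ (suc j) would not be found.
module _ (j : ℕ) where

  private
    K : ℚ
    K = mkℚ (ℤ.+ suc j) 0 (Coprimality.sym (Coprimality.1-coprimeTo (suc j)))

  1/suc : ℚ
  1/suc = ℚ.1/ K

  private
    *1/suc*K : ∀ s → ℕ→ℚ s ℚ.* 1/suc ℚ.* K ≡ ℕ→ℚ s
    *1/suc*K s =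
      trans (ℚ.*-assoc (ℕ→ℚ s) 1/suc K) (trans (cong (ℕ→ℚ s ℚ.*_) (ℚ.*-inverseˡ K)) (ℚ.*-identityʳ _))

    *K : ∀ z → ℕ→ℚ z ℚ.* K ≡ ℕ→ℚ (suc j * z)
    *K z = trans (cong (ℕ→ℚ z ℚ.*_) (sym (ℕ→ℚ≡mkℚ (suc j))))
                 (trans (sym (ℕ→ℚ-* z (suc j))) (cong ℕ→ℚ (*-comm z (suc j))))

  ≤-*1/suc⁺ : ∀ {z s} → suc j * z ≤ s → ℕ→ℚ z ℚ.≤ ℕ→ℚ s ℚ.* 1/suc
  ≤-*1/suc⁺ {z} {s} le =
    ℚ.*-cancelʳ-≤-pos K (subst₂ ℚ._≤_ (sym (*K z)) (sym (*1/suc*K s)) (ℕ→ℚ-mono-≤ le))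

  ≤-*1/suc⁻ : ∀ {z s} → ℕ→ℚ z ℚ.≤ ℕ→ℚ s ℚ.* 1/suc → suc j * z ≤ s
  ≤-*1/suc⁻ {z} {s} le = ℕ→ℚ-cancel-≤ (subst₂ ℚ._≤_ (*K z) (*1/suc*K s) (ℚ.*-monoʳ-≤-nonNeg K le))

-- The weight a / k is feasible for the program defining Z*.
fracZ-bound : (H : Graph) {z : ℕ} → IsFracZ H (ℕ→ℚ z) → ∀ k (a : Fin (n H) → ℕ) →
              (∀ F → IsMinimalFort H F → k ≤ weight F a) → k * z ≤ sum a
fracZ-bound H     _             zero    a _     = z≤n
fracZ-bound H {z} (_ , optimal) (suc j) a cover =
  ≤-*1/suc⁻ j (subst (ℕ→ℚ z ℚ.≤_) (Σℚ-ℕ→ℚ-* (1/suc j) a) (optimal x (x≥0 , x-covers)))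
  where
  x : Fin (n H) → ℚ
  x v = ℕ→ℚ (a v) ℚ.* 1/suc j

  x≥0 : ∀ v → 0ℚ ℚ.≤ x v
  x≥0 v = ≤-*1/suc⁺ j (subst (_≤ a v) (sym (*-zeroʳ (suc j))) z≤n)

  x-covers : ∀ F → IsMinimalFort H F → 1ℚ ℚ.≤ Σ∈ F x
  x-covers F F-min = subst (1ℚ ℚ.≤_) (sym (Σ∈-ℕ→ℚ-* (1/suc j) F a))
    (≤-*1/suc⁺ j (subst (_≤ weight F a) (sym (*-identityʳ (suc j))) (cover F F-min)))

fracZ-bound-with-slack : (H : Graph) {z : ℕ} → IsFracZ H (ℕ→ℚ z) →
                         ∀ k (c : Fin (n H) → ℕ) v → 0 < c v →
                         (∀ F → IsMinimalFort H F → k + 𝟙 (lookup F v) ≤ weight F c) →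
                         k * z + 1 ≤ sum c
fracZ-bound-with-slack H fracZ k c v 0<cᵥ cover =
  subst (k * _ + 1 ≤_) (sym (sum-updateAt-pred c v 0<cᵥ))
    (+-mono-≤ (fracZ-bound H fracZ k (updateAt c v pred) decremented-cover) (≤-refl {1}))
  where
  decremented-cover : ∀ F → IsMinimalFort H F → k ≤ weight F (updateAt c v pred)
  decremented-cover F F-min =
    +-cancelʳ-≤ _ k _ (subst (k + _ ≤_) (weight-updateAt-pred F c v 0<cᵥ) (cover F F-min))

⌊⌋≡true⇒ : {A : Set} (a? : Dec A) → ⌊ a? ⌋ ≡ true → A
⌊⌋≡true⇒ (yes a) _  = a
⌊⌋≡true⇒ (no _)  ()

⌊≟⌋-sym : (x y : Fin m) → ⌊ x ≟ y ⌋ ≡ ⌊ y ≟ x ⌋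
⌊≟⌋-sym x y =
  trans (isYes≗does (x ≟ y)) (trans (does-⇔ (mk⇔ sym sym) (x ≟ y) (y ≟ x)) (sym (isYes≗does (y ≟ x))))

∨-∧≡true : ∀ a b c d → (a ∧ b) ∨ (c ∧ d) ≡ true → (a ≡ true × b ≡ true) ⊎ (c ≡ true × d ≡ true)
∨-∧≡true true  true  _     _     _  = inj₁ (refl , refl)
∨-∧≡true true  false true  true  _  = inj₂ (refl , refl)
∨-∧≡true false _     true  true  _  = inj₂ (refl , refl)
∨-∧≡true true  false false _     ()
∨-∧≡true true  false true  false ()
∨-∧≡true false _     false _     ()
∨-∧≡true false _     true  false ()

NonIsolated : (G : Graph) → Fin (n G) → Set
NonIsolated G u = ∃ λ v → adj G u v ≡ true

adj⇒≢ : ∀ {G} → IsSimple G → ∀ {u v} → adj G u v ≡ true → u ≢ v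
adj⇒≢ sG {u} u~u refl with trans (sym u~u) (IsSimple.irrefl sG u)
... | ()

fort-second-neighbour : ∀ {G F} → IsFort G F → ∀ {v y} → v ∉ F → adj G v y ≡ true → y ∈ F →
                        ∃ λ z → z ≢ y × adj G v z ≡ true × z ∈ F
fort-second-neighbour {G} {F} (_ , fort) {v} {y} v∉F v~y y∈F
  with any? (λ z → ¬? (z ≟ y) ×-dec (adj G v z Bool.≟ true) ×-dec (z ∈? F))
... | yes found = found
... | no ∄ = ⊥-elim (fort v v∉F (trans (cong ∣_∣ (⊆-antisym N∩F⊆⁅y⁆ ⁅y⁆⊆N∩F)) (∣⁅x⁆∣≡1 y)))
  where
  N∩F⊆⁅y⁆ : N G v ∩ F ⊆ ⁅ y ⁆
  N∩F⊆⁅y⁆ {z} z∈N∩F with z ≟ y | x∈p∩q⁻ (N G v) F z∈N∩F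
  ... | yes refl | _           = x∈⁅x⁆ z
  ... | no z≢y   | z∈N , z∈F = ⊥-elim (∄ (z , z≢y , ∈-tabulate⁻ z∈N , z∈F))

  ⁅y⁆⊆N∩F : ⁅ y ⁆ ⊆ N G v ∩ F
  ⁅y⁆⊆N∩F z∈⁅y⁆ rewrite x∈⁅y⁆⇒x≡y y z∈⁅y⁆ = x∈p∩q⁺ (∈-tabulate⁺ v~y , y∈F)

Filled-trans : ∀ {G S T} → (∀ {u} → u ∈ S → Filled G T u) → ∀ {v} → Filled G S v → Filled G T v
Filled-trans S-filled (initial v∈S)               = S-filled v∈S
Filled-trans S-filled (force u-filled u~v others) =
  force (Filled-trans S-filled u-filled) u~v (λ w u~w w≢v → Filled-trans S-filled (others w u~w w≢v))

isZFS-remove-forced : ∀ {G S u x} → IsSimple G → IsZeroForcingSet G S → u ∈ S → adj G u x ≡ true →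
                      (∀ w → adj G u w ≡ true → w ∈ S) → IsZeroForcingSet G (S - x)
isZFS-remove-forced {G} {S} {u} {x} sG S-zfs u∈S u~x N[u]⊆S v = Filled-trans S-filled (S-zfs v)
  where
  kept : ∀ {w} → w ∈ S → w ≢ x → Filled G (S - x) w
  kept w∈S w≢x = initial (x∈p∧x≢y⇒x∈p-y w∈S w≢x)

  S-filled : ∀ {w} → w ∈ S → Filled G (S - x) w
  S-filled {w} w∈S with w ≟ x
  ... | no w≢x   = kept w∈S w≢x
  ... | yes refl = force (kept u∈S (adj⇒≢ sG u~x)) u~x (λ w u~w w≢x → kept (N[u]⊆S w u~w) w≢x)

InitialForce : (H : Graph) → Subset (n H) → Fin (n H) → Fin (n H) → Set
InitialForce H B b t = b ∈ B × adj H b t ≡ true × (∀ w → adj H b w ≡ true → w ≢ t → w ∈ B)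

module _ (H : Graph) (symm : ∀ i j → adj H i j ≡ adj H j i) (B : Subset (n H))
         (P : Fin (n H) → Set) (P-closed : ∀ {i j} → adj H i j ≡ true → P j → P i) where

  private
    P-closed′ : ∀ {i j} → adj H i j ≡ true → P i → P j
    P-closed′ {i} {j} i~j = P-closed (trans (symm j i) i~j)

    InitialForceIn-P : Set
    InitialForceIn-P = ∃₂ λ b t → P b × InitialForce H B b t

    ready-or-recurse : ∀ {b t} → b ∈ B → P b → adj H b t ≡ true →
                       (∀ w → adj H b w ≡ true → w ≢ t → w ∈ B ⊎ InitialForceIn-P) → InitialForceIn-P
    ready-or-recurse {b} {t} b∈B Pb b~t others
      with any? (λ w → (adj H b w Bool.≟ true) ×-dec ¬? (w ≟ t) ×-dec ¬? (w ∈? B))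
    ... | no ∄ = b , t , Pb , b∈B , b~t , λ w b~w w≢t →
                   decidable-stable (w ∈? B) (λ w∉B → ∄ (w , b~w , w≢t , w∉B))
    ... | yes (w , b~w , w≢t , w∉B) with others w b~w w≢t
    ...   | inj₁ w∈B   = ⊥-elim (w∉B w∈B)
    ...   | inj₂ found = found

    -- If u ∈ B forces v but is not ready to do so, u has a neighbour w ≠ v outside B; w is in P
    -- and its forcing derivation is a smaller instance.
    member-or-force : ∀ {v} → Filled H B v → P v → v ∈ B ⊎ InitialForceIn-P
    member-or-force (initial v∈B) _ = inj₁ v∈B
    member-or-force (force {u} u-filled u~v others) Pv with member-or-force u-filled (P-closed u~v Pv)
    ... | inj₂ found = inj₂ found
    ... | inj₁ u∈B   = inj₂ (ready-or-recurse u∈B Pu u~v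
                               (λ w u~w w≢v → member-or-force (others w u~w w≢v) (P-closed′ u~w Pu)))
      where Pu = P-closed u~v Pv

  initialForce-exists : IsZeroForcingSet H B → ∀ {i} → P i → NonIsolated H i →
                        ∃₂ λ b t → P b × InitialForce H B b t
  initialForce-exists zfs Pi (t , i~t) with member-or-force (zfs _) Pi
  ... | inj₂ found = found
  ... | inj₁ i∈B   = ready-or-recurse i∈B Pi i~t (λ w i~w _ → member-or-force (zfs w) (P-closed′ i~w Pi))

module Product (G G' : Graph) where

  _⊗_ : Fin (n G) → Fin (n G') → Fin (n (G □ G'))
  u ⊗ u' = combine u u'

  fst : Fin (n (G □ G')) → Fin (n G)
  fst i = proj₁ (remQuot {n G} (n G') i)

  snd : Fin (n (G □ G')) → Fin (n G')
  snd i = proj₂ (remQuot {n G} (n G') i)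

  fst-⊗ : ∀ u u' → fst (u ⊗ u') ≡ u
  fst-⊗ u u' = cong proj₁ (remQuot-combine {n G} {n G'} u u')

  snd-⊗ : ∀ u u' → snd (u ⊗ u') ≡ u'
  snd-⊗ u u' = cong proj₂ (remQuot-combine {n G} {n G'} u u')

  ⊗-η : ∀ i → fst i ⊗ snd i ≡ i
  ⊗-η i = combine-remQuot {n G} (n G') i

  □-adj : ∀ i j → adj (G □ G') i j ≡ (⌊ fst i ≟ fst j ⌋ ∧ adj G' (snd i) (snd j))
                                    ∨ (⌊ snd i ≟ snd j ⌋ ∧ adj G (fst i) (fst j))
  □-adj i j with remQuot {n G} (n G') i | remQuot {n G} (n G') j
  ... | _ , _ | _ , _ = refl

  □-adj⁻ : ∀ {i j} → adj (G □ G') i j ≡ true →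
           (fst i ≡ fst j × adj G' (snd i) (snd j) ≡ true)
         ⊎ (snd i ≡ snd j × adj G (fst i) (fst j) ≡ true)
  □-adj⁻ {i} {j} i~j with ∨-∧≡true _ _ _ _ (trans (sym (□-adj i j)) i~j)
  ... | inj₁ (fst≡ , snd~) = inj₁ (⌊⌋≡true⇒ (fst i ≟ fst j) fst≡ , snd~)
  ... | inj₂ (snd≡ , fst~) = inj₂ (⌊⌋≡true⇒ (snd i ≟ snd j) snd≡ , fst~)

  □-adj-vertical : ∀ i {v'} → adj G' (snd i) v' ≡ true → adj (G □ G') i (fst i ⊗ v') ≡ true
  □-adj-vertical i {v'} snd~ rewrite □-adj i (fst i ⊗ v') | fst-⊗ (fst i) v' | snd-⊗ (fst i) v'
                                   | ≡-≟-identity _≟_ (refl {x = fst i}) | snd~ = refl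

  □-adj-horizontal : ∀ i {v} → adj G (fst i) v ≡ true → adj (G □ G') i (v ⊗ snd i) ≡ true
  □-adj-horizontal i {v} fst~ rewrite □-adj i (v ⊗ snd i) | fst-⊗ v (snd i) | snd-⊗ v (snd i)
                                    | ≡-≟-identity _≟_ (refl {x = snd i}) | fst~ = ∨-zeroʳ _

  □-symm : IsSimple G → IsSimple G' → ∀ i j → adj (G □ G') i j ≡ adj (G □ G') j i
  □-symm sG sG' i j = trans (□-adj i j) (trans
    (cong₂ _∨_ (cong₂ _∧_ (⌊≟⌋-sym (fst i) (fst j)) (IsSimple.symm sG' (snd i) (snd j)))
               (cong₂ _∧_ (⌊≟⌋-sym (snd i) (snd j)) (IsSimple.symm sG (fst i) (fst j))))
    (sym (□-adj j i)))

  NonIsolatedInBoth : Fin (n (G □ G')) → Set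
  NonIsolatedInBoth i = NonIsolated G (fst i) × NonIsolated G' (snd i)

  nonIsolatedInBoth-⊗ : ∀ {u u'} → NonIsolated G u → NonIsolated G' u' → NonIsolatedInBoth (u ⊗ u')
  nonIsolatedInBoth-⊗ {u} {u'} Nu Nu' =
    subst (NonIsolated G) (sym (fst-⊗ u u')) Nu , subst (NonIsolated G') (sym (snd-⊗ u u')) Nu'

  nonIsolatedInBoth⇒nonIsolated : ∀ {i} → NonIsolatedInBoth i → NonIsolated (G □ G') i
  nonIsolatedInBoth⇒nonIsolated {i} ((v , fst~v) , _) = v ⊗ snd i , □-adj-horizontal i fst~v

  nonIsolatedInBoth-closed : ∀ {i j} → adj (G □ G') i j ≡ true →
                             NonIsolatedInBoth j → NonIsolatedInBoth i
  nonIsolatedInBoth-closed {i} {j} i~j (Nfst , Nsnd) with □-adj⁻ i~j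
  ... | inj₁ (fst≡ , snd~) = subst (NonIsolated G) (sym fst≡) Nfst , (snd j , snd~)
  ... | inj₂ (snd≡ , fst~) = (fst j , fst~) , subst (NonIsolated G') (sym snd≡) Nsnd

module Shadow {G G' : Graph} (B : Subset (n (G □ G'))) where

  open Product G G'

  inB : Fin (n G) → Fin (n G') → Bool
  inB u u' = lookup B (u ⊗ u')

  row : Fin (n G) → Subset (n G')
  row u = tabulate (inB u)

  column : Fin (n G') → Subset (n G)
  column u' = tabulate (λ u → inB u u')

  shadow : Subset (n G') → Subset (n G)
  shadow F' = tabulate (λ u → does (nonempty? (row u ∩ F')))

  ∈row : ∀ {u u'} → u ⊗ u' ∈ B → u' ∈ row u
  ∈row u⊗u'∈B = ∈-tabulate⁺ ([]=⇒lookup u⊗u'∈B)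

  ∈column : ∀ {u u'} → u ⊗ u' ∈ B → u ∈ column u'
  ∈column u⊗u'∈B = ∈-tabulate⁺ ([]=⇒lookup u⊗u'∈B)

  ∈shadow : ∀ {F' u u'} → u ⊗ u' ∈ B → u' ∈ F' → u ∈ shadow F'
  ∈shadow u⊗u'∈B u'∈F' = ∈-tabulate⁺ (dec-true (nonempty? _) (_ , x∈p∩q⁺ (∈row u⊗u'∈B , u'∈F')))

  -- A force along G projects to a force of G.  A force along G' out of j with snd j ∉ F' is
  -- traced back through a second neighbour of snd j in F', which the fort property provides.
  shadow-filled : ∀ {F'} → IsFort G' F' → ∀ {i} → Filled (G □ G') B i → snd i ∈ F' →
                  Filled G (shadow F') (fst i)
  shadow-filled fort (initial i∈B) snd∈F' = initial (∈shadow (subst (_∈ B) (sym (⊗-η _)) i∈B) snd∈F')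
  shadow-filled {F'} fort {i} (force {j} j-filled j~i others) snd∈F' with □-adj⁻ j~i
  ... | inj₂ (snd≡ , fst~) =
    force (shadow-filled fort j-filled (subst (_∈ F') (sym snd≡) snd∈F')) fst~ others′
    where
    others′ : ∀ v → adj G (fst j) v ≡ true → v ≢ fst i → Filled G (shadow F') v
    others′ v fst~v v≢ = subst (Filled G (shadow F')) (fst-⊗ v (snd j))
      (shadow-filled fort (others (v ⊗ snd j) (□-adj-horizontal j fst~v)
                                  (λ eq → v≢ (trans (sym (fst-⊗ v (snd j))) (cong fst eq))))
                          (subst (_∈ F') (sym (trans (snd-⊗ v (snd j)) snd≡)) snd∈F'))
  ... | inj₁ (fst≡ , snd~) with snd j ∈? F'
  ...   | yes sndj∈F' = subst (Filled G (shadow F')) fst≡ (shadow-filled fort j-filled sndj∈F')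
  ...   | no sndj∉F' with fort-second-neighbour fort sndj∉F' snd~ snd∈F'
  ...     | z' , z'≢ , snd~z' , z'∈F' = subst (Filled G (shadow F')) (trans (fst-⊗ (fst j) z') fst≡)
    (shadow-filled fort (others (fst j ⊗ z') (□-adj-vertical j snd~z')
                                (λ eq → z'≢ (trans (sym (snd-⊗ (fst j) z')) (cong snd eq))))
                        (subst (_∈ F') (sym (snd-⊗ (fst j) z')) z'∈F'))

  shadow-isZFS : ∀ {F'} → IsFort G' F' → IsZeroForcingSet (G □ G') B → IsZeroForcingSet G (shadow F')
  shadow-isZFS {F'} fort zfs u with proj₁ fort
  ... | u' , u'∈F' = subst (Filled G (shadow F')) (fst-⊗ u u')
                       (shadow-filled fort (zfs (u ⊗ u')) (subst (_∈ F') (sym (snd-⊗ u u')) u'∈F'))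

  col : Fin (n G') → ℕ
  col u' = ∣ column u' ∣

  sum-col : sum col ≡ ∣ B ∣
  sum-col = begin
    ∑[ u' < n G' ] ∣ column u' ∣             ≡⟨ sum-cong-≗ (λ u' → ∣tabulate∣≡∑𝟙 (λ u → inB u u')) ⟩
    ∑[ u' < n G' ] ∑[ u < n G ] 𝟙 (inB u u') ≡⟨ ∑-comm (λ u u' → 𝟙 (inB u u')) ⟨
    ∑[ u < n G ] ∑[ u' < n G' ] 𝟙 (inB u u') ≡⟨ sum-combine (n G) (n G') (𝟙 ∘ lookup B) ⟨
    ∑[ i < n G * n G' ] 𝟙 (lookup B i)       ≡⟨ ∣p∣≡∑𝟙 B ⟨
    ∣ B ∣                                     ∎
    where open ≡-Reasoning

  weight-col : ∀ F' → weight F' col ≡ ∑[ u < n G ] ∣ row u ∩ F' ∣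
  weight-col F' = begin
    ∑[ u' < n G' ] (if lookup F' u' then ∣ column u' ∣ else 0)
      ≡⟨ sum-cong-≗ (λ u' → cong (λ c → if lookup F' u' then c else 0) (∣tabulate∣≡∑𝟙 (λ u → inB u u'))) ⟩
    ∑[ u' < n G' ] (if lookup F' u' then ∑[ u < n G ] 𝟙 (inB u u') else 0)
      ≡⟨ sum-cong-≗ (λ u' → sum-if (lookup F' u') (λ u → 𝟙 (inB u u'))) ⟨
    ∑[ u' < n G' ] ∑[ u < n G ] (if lookup F' u' then 𝟙 (inB u u') else 0)
      ≡⟨ ∑-comm (λ u u' → if lookup F' u' then 𝟙 (inB u u') else 0) ⟨
    ∑[ u < n G ] ∑[ u' < n G' ] (if lookup F' u' then 𝟙 (inB u u') else 0)
      ≡⟨ sum-cong-≗ (λ u → sum-cong-≗ (𝟙-row∩ u)) ⟨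
    ∑[ u < n G ] ∑[ u' < n G' ] 𝟙 (lookup (row u ∩ F') u')
      ≡⟨ sum-cong-≗ (λ u → ∣p∣≡∑𝟙 (row u ∩ F')) ⟨
    ∑[ u < n G ] ∣ row u ∩ F' ∣
      ∎
    where
    open ≡-Reasoning
    𝟙-row∩ : ∀ u u' → 𝟙 (lookup (row u ∩ F') u') ≡ (if lookup F' u' then 𝟙 (inB u u') else 0)
    𝟙-row∩ u u' = begin
      𝟙 (lookup (row u ∩ F') u')
        ≡⟨ cong 𝟙 (trans (lookup-zipWith _∧_ u' (row u) F')
                         (cong (_∧ lookup F' u') (lookup∘tabulate (inB u) u'))) ⟩
      𝟙 (inB u u' ∧ lookup F' u')
        ≡⟨ if-∧ (inB u u') ⟩
      (if inB u u' then 𝟙 (lookup F' u') else 0)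
        ≡⟨ if-swap-then (lookup F' u') (inB u u') ⟨
      (if lookup F' u' then 𝟙 (inB u u') else 0)
        ∎

  ∣shadow∣≡∑𝟙 : ∀ F' → ∣ shadow F' ∣ ≡ ∑[ u < n G ] 𝟙 (does (nonempty? (row u ∩ F')))
  ∣shadow∣≡∑𝟙 F' = ∣tabulate∣≡∑𝟙 (λ u → does (nonempty? (row u ∩ F')))

  ∣shadow∣≤weight : ∀ F' → ∣ shadow F' ∣ ≤ weight F' col
  ∣shadow∣≤weight F' = begin
    ∣ shadow F' ∣
      ≡⟨ ∣shadow∣≡∑𝟙 F' ⟩
    ∑[ u < n G ] 𝟙 (does (nonempty? (row u ∩ F')))
      ≤⟨ sum-mono-≤ (λ u → nonempty?-indicator≤∣p∣ (row u ∩ F')) ⟩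
    ∑[ u < n G ] ∣ row u ∩ F' ∣
      ≡⟨ weight-col F' ⟨
    weight F' col
      ∎
    where open ≤-Reasoning

  ∣shadow∣<weight : ∀ {F' u y' z'} → u ⊗ y' ∈ B → u ⊗ z' ∈ B → y' ∈ F' → z' ∈ F' → y' ≢ z' →
                    ∣ shadow F' ∣ < weight F' col
  ∣shadow∣<weight {F'} {u} u⊗y'∈B u⊗z'∈B y'∈F' z'∈F' y'≢z' = begin-strict
    ∣ shadow F' ∣
      ≡⟨ ∣shadow∣≡∑𝟙 F' ⟩
    ∑[ u < n G ] 𝟙 (does (nonempty? (row u ∩ F')))
      <⟨ sum-mono-< (λ u → nonempty?-indicator≤∣p∣ (row u ∩ F')) u two ⟩
    ∑[ u < n G ] ∣ row u ∩ F' ∣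
      ≡⟨ weight-col F' ⟨
    weight F' col
      ∎
    where
    open ≤-Reasoning
    two : 𝟙 (does (nonempty? (row u ∩ F'))) < ∣ row u ∩ F' ∣
    two = nonempty?-indicator<∣p∣ (x∈p∩q⁺ (∈row u⊗y'∈B , y'∈F')) (x∈p∩q⁺ (∈row u⊗z'∈B , z'∈F')) y'≢z'

module HeavyColumn {G G' : Graph} (sG : IsSimple G) (sG' : IsSimple G')
                   (B : Subset (n (G □ G'))) (zfs : IsZeroForcingSet (G □ G') B)
                   (k : ℕ) (k≤ : ∀ S → IsZeroForcingSet G S → k ≤ ∣ S ∣) where

  open Product G G'
  open Shadow {G} {G'} B

  fort-weight : ∀ {F'} → IsFort G' F' → k ≤ weight F' col
  fort-weight fort = ≤-trans (k≤ _ (shadow-isZFS fort zfs)) (∣shadow∣≤weight _)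

  Heavy : Fin (n G') → Set
  Heavy v₀ = 0 < col v₀ × (∀ F' → IsFort G' F' → v₀ ∈ F' → k < weight F' col)

  -- Every G'-neighbour of b lies in B, so the row of fst b meets each fort through y' twice.
  heavy-via-row : ∀ {b t} → InitialForce (G □ G') B b t → fst b ≢ fst t → NonIsolated G' (snd b) →
                  ∃ Heavy
  heavy-via-row {b} {t} (b∈B , _ , others) fst≢ (y' , snd~y') =
    y' , x∈p⇒0<∣p∣ (∈column (row-b snd~y')) , heavy
    where
    row-b : ∀ {v'} → adj G' (snd b) v' ≡ true → fst b ⊗ v' ∈ B
    row-b {v'} snd~v' =
      others _ (□-adj-vertical b snd~v') (λ eq → fst≢ (trans (sym (fst-⊗ (fst b) v')) (cong fst eq)))

    second-in-row : ∀ {F'} → IsFort G' F' → y' ∈ F' → ∃ λ z' → fst b ⊗ z' ∈ B × z' ∈ F' × y' ≢ z'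
    second-in-row {F'} fort y'∈F' with snd b ∈? F'
    ... | yes snd∈F' = snd b , subst (_∈ B) (sym (⊗-η b)) b∈B , snd∈F' , adj⇒≢ sG' snd~y' ∘ sym
    ... | no snd∉F' with fort-second-neighbour fort snd∉F' snd~y' y'∈F'
    ...   | z' , z'≢y' , snd~z' , z'∈F' = z' , row-b snd~z' , z'∈F' , z'≢y' ∘ sym

    heavy : ∀ F' → IsFort G' F' → y' ∈ F' → k < weight F' col
    heavy F' fort y'∈F' with second-in-row fort y'∈F'
    ... | z' , z'∈B , z'∈F' , y'≢z' =
      ≤-<-trans (k≤ _ (shadow-isZFS fort zfs)) (∣shadow∣<weight (row-b snd~y') z'∈B y'∈F' z'∈F' y'≢z')

  -- Every G-neighbour of b lies in B, so in the shadow of a fort through snd b the vertex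
  -- fst b forces x, which can therefore be dropped from the shadow.
  heavy-via-column : ∀ {b t} → InitialForce (G □ G') B b t → snd b ≢ snd t → NonIsolated G (fst b) →
                     ∃ Heavy
  heavy-via-column {b} {t} (b∈B , _ , others) snd≢ (x , fst~x) =
    snd b , x∈p⇒0<∣p∣ (∈column b∈B′) , heavy
    where
    b∈B′ : fst b ⊗ snd b ∈ B
    b∈B′ = subst (_∈ B) (sym (⊗-η b)) b∈B

    column-b : ∀ {v} → adj G (fst b) v ≡ true → v ⊗ snd b ∈ B
    column-b {v} fst~v =
      others _ (□-adj-horizontal b fst~v) (λ eq → snd≢ (trans (sym (snd-⊗ v (snd b))) (cong snd eq)))

    heavy : ∀ F' → IsFort G' F' → snd b ∈ F' → k < weight F' col
    heavy F' fort snd∈F' = begin-strict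
      k                  ≤⟨ k≤ _ shadow-x-isZFS ⟩
      ∣ shadow F' - x ∣  <⟨ x∈p⇒∣p-x∣<∣p∣ (∈shadow (column-b fst~x) snd∈F') ⟩
      ∣ shadow F' ∣      ≤⟨ ∣shadow∣≤weight F' ⟩
      weight F' col      ∎
      where
      open ≤-Reasoning
      shadow-x-isZFS : IsZeroForcingSet G (shadow F' - x)
      shadow-x-isZFS = isZFS-remove-forced sG (shadow-isZFS fort zfs) (∈shadow b∈B′ snd∈F') fst~x
                                            (λ _ fst~w → ∈shadow (column-b fst~w) snd∈F')

  heavy-column : (∃₂ λ b t → NonIsolatedInBoth b × InitialForce (G □ G') B b t) → ∃ Heavy
  heavy-column (b , t , (Nfst , Nsnd) , ready@(_ , b~t , _)) with □-adj⁻ b~t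
  ... | inj₁ (_ , snd~) = heavy-via-column ready (adj⇒≢ sG' snd~) Nfst
  ... | inj₂ (_ , fst~) = heavy-via-row ready (adj⇒≢ sG fst~) Nsnd

  fort-weight-with-slack : ∀ {v₀} → Heavy v₀ → ∀ F' → IsFort G' F' →
                           k + 𝟙 (lookup F' v₀) ≤ weight F' col
  fort-weight-with-slack {v₀} (_ , heavy) F' fort with lookup F' v₀ in F'v₀
  ... | true  = subst (_≤ weight F' col) (+-comm 1 k) (heavy F' fort (lookup⇒[]= v₀ F' F'v₀))
  ... | false = subst (_≤ weight F' col) (sym (+-identityʳ k)) (fort-weight fort)

proposition4p7 : (G G' : Graph) → IsSimple G → IsSimple G' →
                 HasEdge G → HasEdge G' →
                 (k k' : ℕ) → IsZ G k → IsZ G' k' → IsFracZ G' (ℕ→ℚ k') →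
                 (m : ℕ) → IsZ (G □ G') m →
                 k * k' + 1 ≤ m
proposition4p7 G G' sG sG' (_ , Nu) (_ , Nu') k k' (_ , k≤) _ fracZ' m ((B , zfs , ∣B∣≡m) , _) =
  let start = nonIsolatedInBoth-⊗ Nu Nu'
      ready = initialForce-exists (G □ G') (□-symm sG sG') B NonIsolatedInBoth nonIsolatedInBoth-closed
                                  zfs start (nonIsolatedInBoth⇒nonIsolated start)
      v₀ , heavy = heavy-column ready
  in begin
    k * k' + 1  ≤⟨ fracZ-bound-with-slack G' fracZ' k col v₀ (proj₁ heavy)
                     (λ F' F'-min → fort-weight-with-slack heavy F' (proj₁ F'-min)) ⟩
    sum col     ≡⟨ sum-col ⟩
    ∣ B ∣       ≡⟨ ∣B∣≡m ⟩
    m           ∎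
  where
  open Product G G'
  open Shadow {G} {G'} B
  open HeavyColumn sG sG' B zfs k k≤
  open ≤-Reasoning
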